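{- Let $\mathbf E=(E,+,{}',0,1)$ be an effect algebra with induced order $\leq$ and put $x\odot y:=(x'+y')'$, defined if and only if $x'\leq y$, and $x\rightarrow y:=x'+L(x,y)$ for $x,y\in E$. Then $(E,\leq,\odot,\rightarrow,{}',0,1)$ is a divisible strict unsharp residuated poset.
   Context: An effect algebra is a partial algebra $(E,+,{}',0,1)$ of type $(2,1,0,0)$ where $+$ is a partial binary operation such that for all $x,y,z\in E$: (E1) $x+y$ is defined iff $y+x$ is defined, and then $x+y=y+x$; (E2) $(x+y)+z$ is defined iff $x+(y+z)$ is defined, and then they are equal; (E3) $x'$ is the unique $u\in E$ with $x+u=1$; (E4) if $1+x$ is defined then $x=0$. The induced order is $x\leq y$ iff $x+z=y$ for some $z$; $x+y$ is defined iff $x\leq y'$; for a set $A$ with $u\leq x'$ for all $u\in A$, $x+A=\{x+u\mid u\in A\}$. In a poset, $L(A)$, $U(A)$ are the sets of lower, resp. upper, bounds of $A$; $L(x,y)=L(\{x,y\})$, $UL(A)=U(L(A))$, etc. A partial commutative monoid $(C,\odot,1)$: $\odot$ partial binary, $(x\odot y)\odot z$ defined iff $x\odot(y\odot z)$ defined and then equal, $x\odot 1=1\odot x=x$, $x\odot y$ defined iff $y\odot x$ defined and then equal. For $A\subseteq C$ and $y$ with $A\odot y$ defined elementwise, $A\odot y=\{a\odot y\mid a\in A\}$; $A'=\{a'\mid a\in A\}$. A strict unsharp residuated poset is $(C,\leq,\odot,\rightarrow,{}',0,1)$ with $\rightarrow:C^2\to 2^C$ such that for all $x,y,z\in C$: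 (C1) $(C,\leq,{}',0,1)$ is a bounded poset with an antitone involution $'$; (C2) $(C,\odot,1)$ is a partial commutative monoid in which $x\odot y$ is defined iff $x'\leq y$; moreover $z'\leq x\leq y$ implies $x\odot z\leq y\odot z$, and $x\leq y$ implies $x=y\odot(y\odot x')'$; (C3) $U(x,y')\odot y\subseteq UL(y,z)$ iff $U(x,y')\subseteq U(y\rightarrow z)$; (C4) $x\rightarrow 0=\{x'\}$. It is divisible if moreover (C5) $x\odot(x\rightarrow y)=L(x,y)$ for all $x,y$ (with $x\odot A=\{x\odot a\mid a\in A\}$). -}

module Defs where

open import Level using (Level)
open import Data.Maybe using (Maybe; just; nothing; _>>=_; map)
open import Data.Product using (Σ; ∃; _×_; _,_)
open import Data.Sum using (_⊎_)
open import Relation.Unary using (Pred; _⊆_; _≐_)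
open import Relation.Binary.PropositionalEquality using (_≡_)

-- Partial binary operations are modelled as total maps into Maybe:
-- "x ∙ y is defined and equals z" is  x ∙ y ≡ just z.

module _ {ℓ : Level} {C : Set ℓ} where

  Defined : Maybe C → Set ℓ
  Defined m = ∃ λ w → m ≡ just w

  pair : C → C → Pred C ℓ
  pair x y w = (w ≡ x) ⊎ (w ≡ y)

  sing : C → Pred C ℓ
  sing x w = w ≡ x

  module Bounds (_≤_ : C → C → Set ℓ) where
    U : Pred C ℓ → Pred C ℓ
    U A u = ∀ a → A a → a ≤ u

    L : Pred C ℓ → Pred C ℓ
    L A l = ∀ a → A a → l ≤ a

  imageʳ : (C → C → Maybe C) → Pred C ℓ → C → Pred C ℓ
  imageʳ _∙_ A y w = ∃ λ a → A a × (a ∙ y) ≡ just w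

  imageˡ : (C → C → Maybe C) → C → Pred C ℓ → Pred C ℓ
  imageˡ _∙_ x A w = ∃ λ a → A a × (x ∙ a) ≡ just w

record IsEffectAlgebra {ℓ : Level} (E : Set ℓ) (_⊕_ : E → E → Maybe E)
                       (_′ : E → E) (𝟘 𝟙 : E) : Set ℓ where
  field
    comm   : ∀ x y → (x ⊕ y) ≡ (y ⊕ x)
    assoc  : ∀ x y z → ((x ⊕ y) >>= λ u → u ⊕ z) ≡ ((y ⊕ z) >>= λ v → x ⊕ v)
    compl  : ∀ x → (x ⊕ (x ′)) ≡ just 𝟙
    compl-unique : ∀ x u → (x ⊕ u) ≡ just 𝟙 → u ≡ x ′
    zero-one : ∀ x → Defined (𝟙 ⊕ x) → x ≡ 𝟘

module EffectAlgebraOps {ℓ : Level} (E : Set ℓ) (_⊕_ : E → E → Maybe E)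
                        (_′ : E → E) (𝟘 𝟙 : E) where
  _≤ₑ_ : E → E → Set ℓ
  x ≤ₑ y = ∃ λ z → (x ⊕ z) ≡ just y

  open Bounds _≤ₑ_ public

  _⊙ₑ_ : E → E → Maybe E
  x ⊙ₑ y = map _′ ((x ′) ⊕ (y ′))

  _⇒ₑ_ : E → E → Pred E ℓ
  x ⇒ₑ y = imageˡ _⊕_ (x ′) (L (pair x y))

record IsStrictUnsharpResiduatedPoset {ℓ : Level} (C : Set ℓ)
       (_≤_ : C → C → Set ℓ) (_⊙_ : C → C → Maybe C) (_⇒_ : C → C → Pred C ℓ)
       (_′ : C → C) (𝟘 𝟙 : C) : Set ℓ where
  open Bounds _≤_
  field
    ≤-refl    : ∀ x → x ≤ x
    ≤-antisym : ∀ x y → x ≤ y → y ≤ x → x ≡ y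
    ≤-trans   : ∀ x y z → x ≤ y → y ≤ z → x ≤ z
    ≤-bot     : ∀ x → 𝟘 ≤ x
    ≤-top     : ∀ x → x ≤ 𝟙
    ′-invol   : ∀ x → (x ′) ′ ≡ x
    ′-antitone : ∀ x y → x ≤ y → (y ′) ≤ (x ′)
    ⊙-assoc   : ∀ x y z → ((x ⊙ y) >>= λ u → u ⊙ z) ≡ ((y ⊙ z) >>= λ v → x ⊙ v)
    ⊙-identityʳ : ∀ x → (x ⊙ 𝟙) ≡ just x
    ⊙-identityˡ : ∀ x → (𝟙 ⊙ x) ≡ just x
    ⊙-comm    : ∀ x y → (x ⊙ y) ≡ (y ⊙ x)
    ⊙-defined→ : ∀ x y → Defined (x ⊙ y) → (x ′) ≤ y
    ⊙-defined← : ∀ x y → (x ′) ≤ y → Defined (x ⊙ y)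
    ⊙-mono    : ∀ x y z → (z ′) ≤ x → x ≤ y →
                Σ C λ u → Σ C λ v → (x ⊙ z) ≡ just u × (y ⊙ z) ≡ just v × u ≤ v
    ⊙-divide  : ∀ x y → x ≤ y →
                Σ C λ w → (y ⊙ (x ′)) ≡ just w × (y ⊙ (w ′)) ≡ just x
    residuation→ : ∀ x y z →
      imageʳ _⊙_ (U (pair x (y ′))) y ⊆ U (L (pair y z)) →
      U (pair x (y ′)) ⊆ U (y ⇒ z)
    residuation← : ∀ x y z →
      U (pair x (y ′)) ⊆ U (y ⇒ z) →
      imageʳ _⊙_ (U (pair x (y ′))) y ⊆ U (L (pair y z))
    ⇒-zero : ∀ x → (x ⇒ 𝟘) ≐ sing (x ′)

record IsDivisibleStrictUnsharpResiduatedPoset {ℓ : Level} (C : Set ℓ)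
       (_≤_ : C → C → Set ℓ) (_⊙_ : C → C → Maybe C) (_⇒_ : C → C → Pred C ℓ)
       (_′ : C → C) (𝟘 𝟙 : C) : Set ℓ where
  open Bounds _≤_
  field
    isSURP : IsStrictUnsharpResiduatedPoset C _≤_ _⊙_ _⇒_ _′ 𝟘 𝟙
    divisible : ∀ x y → imageˡ _⊙_ x (x ⇒ y) ≐ L (pair x y)

module Submission where

open import Level using (Level)
open import Data.Maybe using (Maybe; just; nothing; _>>=_; map)
open import Data.Maybe.Properties using (just-injective; map-just)
open import Data.Product using (Σ; ∃; _×_; _,_)
open import Data.Sum using (inj₁; inj₂)
open import Relation.Binary.PropositionalEquality
open import Relation.Unary using (_⊆_; _≐_)
open import Defs

-- The residuation law reduces, after unfolding a ⊙ y = (a′ ⊕ y′)′, to the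
-- equivalence  l ⊕ y′ ≤ a ⇔ l ≤ (y′ ⊕ a′)′,  which is partial associativity
-- together with the characterisation "u ⊕ v is defined iff u ≤ v′".
-- Divisibility is the identity x ⊙ (x′ ⊕ l) = l for l ≤ x.

module EffectAlgebraProperties
  {ℓ : Level} {E : Set ℓ} {_⊕_ : E → E → Maybe E} {_′ : E → E} {𝟘 𝟙 : E}
  (isEffectAlgebra : IsEffectAlgebra E _⊕_ _′ 𝟘 𝟙) where

  open IsEffectAlgebra isEffectAlgebra
  open EffectAlgebraOps E _⊕_ _′ 𝟘 𝟙

  bind-just : ∀ {A B : Set ℓ} {w : B} (m : Maybe A) (f : A → Maybe B) →
              (m >>= f) ≡ just w → Σ A λ v → m ≡ just v × f v ≡ just w
  bind-just (just v) f eq = v , refl , eq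

  ⊕-assocʳ : ∀ {x y z u w} → x ⊕ y ≡ just u → u ⊕ z ≡ just w →
             Σ E λ v → y ⊕ z ≡ just v × x ⊕ v ≡ just w
  ⊕-assocʳ {x} {y} {z} e₁ e₂ =
    bind-just (y ⊕ z) (x ⊕_)
      (trans (sym (assoc x y z)) (trans (cong (_>>= _⊕ z) e₁) e₂))

  ⊕-assocˡ : ∀ {x y z v w} → y ⊕ z ≡ just v → x ⊕ v ≡ just w →
             Σ E λ u → x ⊕ y ≡ just u × u ⊕ z ≡ just w
  ⊕-assocˡ {x} {y} {z} e₁ e₂ =
    bind-just (x ⊕ y) (_⊕ z)
      (trans (assoc x y z) (trans (cong (_>>= x ⊕_) e₁) e₂))

  ⊕-complementˡ : ∀ x → (x ′) ⊕ x ≡ just 𝟙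
  ⊕-complementˡ x = trans (comm (x ′) x) (compl x)

  ′-involutive : ∀ x → (x ′) ′ ≡ x
  ′-involutive x = sym (compl-unique (x ′) x (⊕-complementˡ x))

  ′-injective : ∀ {x y} → x ′ ≡ y ′ → x ≡ y
  ′-injective {x} {y} eq =
    trans (sym (′-involutive x)) (trans (cong _′ eq) (′-involutive y))

  x⊕y≡w⇒y⊕w′≡x′ : ∀ {x y w} → x ⊕ y ≡ just w → y ⊕ (w ′) ≡ just (x ′)
  x⊕y≡w⇒y⊕w′≡x′ {x} {y} {w} e with ⊕-assocʳ e (compl w)
  ... | v , y⊕w′≡v , x⊕v≡𝟙 rewrite compl-unique x v x⊕v≡𝟙 = y⊕w′≡v

  ⊕-cancelˡ : ∀ {x y z w} → x ⊕ y ≡ just w → x ⊕ z ≡ just w → y ≡ z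
  ⊕-cancelˡ e₁ e₂ = ′-injective (just-injective (trans
    (sym (x⊕y≡w⇒y⊕w′≡x′ (x⊕y≡w⇒y⊕w′≡x′ e₁)))
    (x⊕y≡w⇒y⊕w′≡x′ (x⊕y≡w⇒y⊕w′≡x′ e₂))))

  𝟙′≡𝟘 : 𝟙 ′ ≡ 𝟘
  𝟙′≡𝟘 = zero-one (𝟙 ′) (𝟙 , compl 𝟙)

  ⊕-identityʳ : ∀ x → x ⊕ 𝟘 ≡ just x
  ⊕-identityʳ x = subst (λ t → x ⊕ t ≡ just x) 𝟙′≡𝟘
    (subst (λ t → x ⊕ (𝟙 ′) ≡ just t) (′-involutive x)
      (x⊕y≡w⇒y⊕w′≡x′ (⊕-complementˡ x)))

  ⊕-identityˡ : ∀ x → 𝟘 ⊕ x ≡ just x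
  ⊕-identityˡ x = trans (comm 𝟘 x) (⊕-identityʳ x)

  ⊕-positiveʳ : ∀ {a b} → a ⊕ b ≡ just 𝟘 → b ≡ 𝟘
  ⊕-positiveʳ {a} {b} e with ⊕-assocʳ e (⊕-identityˡ 𝟙)
  ... | v , b⊕𝟙≡v , _ = zero-one b (v , trans (comm 𝟙 b) b⊕𝟙≡v)

  ⊕-defined⇒≤′ : ∀ {x y w} → x ⊕ y ≡ just w → x ≤ₑ (y ′)
  ⊕-defined⇒≤′ {x} {y} e = _ , x⊕y≡w⇒y⊕w′≡x′ (trans (comm y x) e)

  ≤′⇒⊕-defined : ∀ {x y} → x ≤ₑ (y ′) → Defined (x ⊕ y)
  ≤′⇒⊕-defined {x} {y} (z , x⊕z≡y′) with ⊕-assocʳ x⊕z≡y′ (compl (y ′))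
  ... | v , z⊕y′′≡v , x⊕v≡𝟙 rewrite ′-involutive y
    with ⊕-assocˡ (trans (comm y z) z⊕y′′≡v) x⊕v≡𝟙
  ... | u , x⊕y≡u , _ = u , x⊕y≡u

  ≤⇒⊕′-defined : ∀ {x y} → x ≤ₑ y → Defined (x ⊕ (y ′))
  ≤⇒⊕′-defined {x} {y} x≤y = ≤′⇒⊕-defined (subst (x ≤ₑ_) (sym (′-involutive y)) x≤y)

  ≤-refl : ∀ x → x ≤ₑ x
  ≤-refl x = 𝟘 , ⊕-identityʳ x

  ≤-trans : ∀ x y z → x ≤ₑ y → y ≤ₑ z → x ≤ₑ z
  ≤-trans x y z (a , x⊕a≡y) (b , y⊕b≡z) with ⊕-assocʳ x⊕a≡y y⊕b≡z
  ... | v , _ , x⊕v≡z = v , x⊕v≡z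

  ≤-antisym : ∀ x y → x ≤ₑ y → y ≤ₑ x → x ≡ y
  ≤-antisym x y (a , x⊕a≡y) (b , y⊕b≡x) with ⊕-assocʳ x⊕a≡y y⊕b≡x
  ... | v , a⊕b≡v , x⊕v≡x with ⊕-cancelˡ x⊕v≡x (⊕-identityʳ x)
  ... | refl with ⊕-positiveʳ a⊕b≡v
  ... | refl = just-injective (trans (sym y⊕b≡x) (⊕-identityʳ y))

  ′-antitone : ∀ x y → x ≤ₑ y → (y ′) ≤ₑ (x ′)
  ′-antitone x y (z , x⊕z≡y) = z , trans (comm (y ′) z) (x⊕y≡w⇒y⊕w′≡x′ x⊕z≡y)

  ⊕-monoˡ-≤ : ∀ {a b c q} → a ≤ₑ b → b ⊕ c ≡ just q →
              Σ E λ p → a ⊕ c ≡ just p × p ≤ₑ q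
  ⊕-monoˡ-≤ (d , a⊕d≡b) b⊕c≡q with ⊕-assocʳ a⊕d≡b b⊕c≡q
  ... | v , d⊕c≡v , a⊕v≡q with ⊕-assocˡ (trans (comm _ _) d⊕c≡v) a⊕v≡q
  ... | p , a⊕c≡p , p⊕d≡q = p , a⊕c≡p , (_ , p⊕d≡q)

  l⊕c≤a⇒l≤[c⊕a′]′ : ∀ {a c l p q} → c ⊕ (a ′) ≡ just p → l ⊕ c ≡ just q →
                    q ≤ₑ a → l ≤ₑ (p ′)
  l⊕c≤a⇒l≤[c⊕a′]′ c⊕a′≡p l⊕c≡q q≤a with ≤⇒⊕′-defined q≤a
  ... | r , q⊕a′≡r with ⊕-assocʳ l⊕c≡q q⊕a′≡r
  ... | v , c⊕a′≡v , l⊕v≡r rewrite just-injective (trans (sym c⊕a′≡v) c⊕a′≡p) =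
    ⊕-defined⇒≤′ l⊕v≡r

  l≤[c⊕a′]′⇒l⊕c≤a : ∀ {a c l p q} → c ⊕ (a ′) ≡ just p → l ⊕ c ≡ just q →
                    l ≤ₑ (p ′) → q ≤ₑ a
  l≤[c⊕a′]′⇒l⊕c≤a {a} c⊕a′≡p l⊕c≡q l≤p′ with ≤′⇒⊕-defined l≤p′
  ... | r , l⊕p≡r with ⊕-assocˡ c⊕a′≡p l⊕p≡r
  ... | u , l⊕c≡u , u⊕a′≡r rewrite just-injective (trans (sym l⊕c≡u) l⊕c≡q) =
    subst (_ ≤ₑ_) (′-involutive a) (⊕-defined⇒≤′ u⊕a′≡r)

  map′-bind : ∀ (m : Maybe E) (g : E → Maybe E) →
              (map _′ m >>= λ u → map _′ (g (u ′))) ≡ map _′ (m >>= g)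
  map′-bind nothing  g = refl
  map′-bind (just u) g = cong (λ t → map _′ (g t)) (′-involutive u)

  ⊙-assoc : ∀ x y z → ((x ⊙ₑ y) >>= λ u → u ⊙ₑ z) ≡ ((y ⊙ₑ z) >>= λ v → x ⊙ₑ v)
  ⊙-assoc x y z = begin
    (map _′ ((x ′) ⊕ (y ′)) >>= λ u → map _′ ((u ′) ⊕ (z ′)))
      ≡⟨ map′-bind ((x ′) ⊕ (y ′)) (_⊕ (z ′)) ⟩
    map _′ (((x ′) ⊕ (y ′)) >>= _⊕ (z ′))
      ≡⟨ cong (map _′) (assoc (x ′) (y ′) (z ′)) ⟩
    map _′ (((y ′) ⊕ (z ′)) >>= (x ′) ⊕_)
      ≡⟨ sym (map′-bind ((y ′) ⊕ (z ′)) ((x ′) ⊕_)) ⟩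
    (map _′ ((y ′) ⊕ (z ′)) >>= λ v → map _′ ((x ′) ⊕ (v ′))) ∎
    where open ≡-Reasoning

  ⊙-comm : ∀ x y → (x ⊙ₑ y) ≡ (y ⊙ₑ x)
  ⊙-comm x y = cong (map _′) (comm (x ′) (y ′))

  ⊙-identityʳ : ∀ x → (x ⊙ₑ 𝟙) ≡ just x
  ⊙-identityʳ x = begin
    map _′ ((x ′) ⊕ (𝟙 ′)) ≡⟨ cong (λ t → map _′ ((x ′) ⊕ t)) 𝟙′≡𝟘 ⟩
    map _′ ((x ′) ⊕ 𝟘)     ≡⟨ map-just (⊕-identityʳ (x ′)) ⟩
    just ((x ′) ′)         ≡⟨ cong just (′-involutive x) ⟩
    just x                 ∎
    where open ≡-Reasoning

  ⊙-identityˡ : ∀ x → (𝟙 ⊙ₑ x) ≡ just x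
  ⊙-identityˡ x = trans (⊙-comm 𝟙 x) (⊙-identityʳ x)

  ⊙-defined⇒′≤ : ∀ x y → Defined (x ⊙ₑ y) → (x ′) ≤ₑ y
  ⊙-defined⇒′≤ x y d with (x ′) ⊕ (y ′) in eq
  ⊙-defined⇒′≤ x y (_ , ()) | nothing
  ... | just _ = subst ((x ′) ≤ₑ_) (′-involutive y) (⊕-defined⇒≤′ eq)

  ′≤⇒⊙-defined : ∀ x y → (x ′) ≤ₑ y → Defined (x ⊙ₑ y)
  ′≤⇒⊙-defined x y x′≤y with ≤⇒⊕′-defined x′≤y
  ... | u , e = u ′ , map-just e

  ⊙-monoˡ-≤ : ∀ x y z → (z ′) ≤ₑ x → x ≤ₑ y →
              Σ E λ u → Σ E λ v → (x ⊙ₑ z) ≡ just u × (y ⊙ₑ z) ≡ just v × u ≤ₑ v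
  ⊙-monoˡ-≤ x y z z′≤x x≤y with ≤⇒⊕′-defined z′≤x
  ... | p , z′⊕x′≡p with ⊕-monoˡ-≤ (′-antitone x y x≤y) (trans (comm (x ′) (z ′)) z′⊕x′≡p)
  ... | q , y′⊕z′≡q , q≤p =
    p ′ , q ′ , map-just (trans (comm (x ′) (z ′)) z′⊕x′≡p) , map-just y′⊕z′≡q ,
    ′-antitone q p q≤p

  -- The quotient w = (y′ ⊕ x)′ is the difference y ⊖ x, the a with x ⊕ a = y.
  ⊙-divide : ∀ x y → x ≤ₑ y → Σ E λ w → (y ⊙ₑ (x ′)) ≡ just w × (y ⊙ₑ (w ′)) ≡ just x
  ⊙-divide x y (a , x⊕a≡y) with ≤⇒⊕′-defined (′-antitone x y (a , x⊕a≡y))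
  ... | s , y′⊕x≡s rewrite ′-involutive x = s ′ , map-just y′⊕x≡s , y⊙s′′≡x
    where
    s′≡a : s ′ ≡ a
    s′≡a = ⊕-cancelˡ
      (subst (λ t → x ⊕ (s ′) ≡ just t) (′-involutive y)
        (x⊕y≡w⇒y⊕w′≡x′ y′⊕x≡s))
      x⊕a≡y

    y⊙s′′≡x : (y ⊙ₑ ((s ′) ′)) ≡ just x
    y⊙s′′≡x = begin
      map _′ ((y ′) ⊕ (((s ′) ′) ′)) ≡⟨ cong (λ t → map _′ ((y ′) ⊕ t)) (′-involutive (s ′)) ⟩
      map _′ ((y ′) ⊕ (s ′))         ≡⟨ cong (λ t → map _′ ((y ′) ⊕ t)) s′≡a ⟩
      map _′ ((y ′) ⊕ a)             ≡⟨ map-just (trans (comm (y ′) a) (x⊕y≡w⇒y⊕w′≡x′ x⊕a≡y)) ⟩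
      just ((x ′) ′)                 ≡⟨ cong just (′-involutive x) ⟩
      just x                         ∎
      where open ≡-Reasoning

  residuation→ : ∀ x y z →
    imageʳ _⊙ₑ_ (U (pair x (y ′))) y ⊆ U (L (pair y z)) →
    U (pair x (y ′)) ⊆ U (y ⇒ₑ z)
  residuation→ x y z H {a} a∈U _ (l , l∈L , y′⊕l≡w)
    with ≤⇒⊕′-defined (′-antitone (y ′) a (a∈U (y ′) (inj₂ refl)))
  ... | p , a′⊕y′≡p rewrite ′-involutive y =
    l≤[c⊕a′]′⇒l⊕c≤a (trans (comm (y ′) (a ′)) a′⊕y′≡p) (trans (comm l (y ′)) y′⊕l≡w)
      (H (a , a∈U , map-just a′⊕y′≡p) l l∈L)

  residuation← : ∀ x y z →
    U (pair x (y ′)) ⊆ U (y ⇒ₑ z) →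
    imageʳ _⊙ₑ_ (U (pair x (y ′))) y ⊆ U (L (pair y z))
  residuation← x y z H (a , a∈U , a⊙y≡w) l l∈L with (a ′) ⊕ (y ′) in a′⊕y′≡p
  residuation← x y z H (a , a∈U , ()) l l∈L | nothing
  ... | just p with a⊙y≡w
  ... | refl with ≤⇒⊕′-defined (l∈L y (inj₁ refl))
  ... | q , l⊕y′≡q =
    l⊕c≤a⇒l≤[c⊕a′]′ (trans (comm (y ′) (a ′)) a′⊕y′≡p) l⊕y′≡q
      (H a∈U q (l , l∈L , trans (comm (y ′) l) l⊕y′≡q))

  ⇒-zero : ∀ x → (x ⇒ₑ 𝟘) ≐ sing (x ′)
  ⇒-zero x = to , from
    where
    to : ∀ {w} → (x ⇒ₑ 𝟘) w → w ≡ x ′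
    to (l , l∈L , x′⊕l≡w) with ≤-antisym l 𝟘 (l∈L 𝟘 (inj₂ refl)) (l , ⊕-identityˡ l)
    ... | refl = just-injective (trans (sym x′⊕l≡w) (⊕-identityʳ (x ′)))

    from : ∀ {w} → w ≡ x ′ → (x ⇒ₑ 𝟘) w
    from refl = 𝟘 , (λ { a (inj₁ refl) → a , ⊕-identityˡ a
                       ; a (inj₂ refl) → a , ⊕-identityˡ a }) ,
                ⊕-identityʳ (x ′)

  x′⊕l≡a⇒x⊙a≡l : ∀ {x l a} → (x ′) ⊕ l ≡ just a → (x ⊙ₑ a) ≡ just l
  x′⊕l≡a⇒x⊙a≡l {x} {l} e =
    trans (map-just (x⊕y≡w⇒y⊕w′≡x′ (trans (comm l (x ′)) e))) (cong just (′-involutive l))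

  ⊙-⇒-divisible : ∀ x y → imageˡ _⊙ₑ_ x (x ⇒ₑ y) ≐ L (pair x y)
  ⊙-⇒-divisible x y = to , from
    where
    to : ∀ {w} → imageˡ _⊙ₑ_ x (x ⇒ₑ y) w → L (pair x y) w
    to (a , (l , l∈L , x′⊕l≡a) , x⊙a≡w)
      rewrite just-injective (trans (sym x⊙a≡w) (x′⊕l≡a⇒x⊙a≡l x′⊕l≡a)) = l∈L

    from : ∀ {l} → L (pair x y) l → imageˡ _⊙ₑ_ x (x ⇒ₑ y) l
    from {l} l∈L with ≤⇒⊕′-defined (l∈L x (inj₁ refl))
    ... | a , l⊕x′≡a =
      a , (l , l∈L , trans (comm (x ′) l) l⊕x′≡a) ,
      x′⊕l≡a⇒x⊙a≡l (trans (comm (x ′) l) l⊕x′≡a)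

theorem7 : {ℓ : Level} (E : Set ℓ) (_⊕_ : E → E → Maybe E) (_′ : E → E) (𝟘 𝟙 : E) →
    IsEffectAlgebra E _⊕_ _′ 𝟘 𝟙 →
    IsDivisibleStrictUnsharpResiduatedPoset E
      (EffectAlgebraOps._≤ₑ_ E _⊕_ _′ 𝟘 𝟙)
      (EffectAlgebraOps._⊙ₑ_ E _⊕_ _′ 𝟘 𝟙)
      (EffectAlgebraOps._⇒ₑ_ E _⊕_ _′ 𝟘 𝟙)
      _′ 𝟘 𝟙
theorem7 E _⊕_ _′ 𝟘 𝟙 isEffectAlgebra = record
  { isSURP = record
    { ≤-refl = ≤-refl ; ≤-antisym = ≤-antisym ; ≤-trans = ≤-trans
    ; ≤-bot = λ x → x , ⊕-identityˡ x
    ; ≤-top = λ x → x ′ , IsEffectAlgebra.compl isEffectAlgebra x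
    ; ′-invol = ′-involutive ; ′-antitone = ′-antitone
    ; ⊙-assoc = ⊙-assoc ; ⊙-identityʳ = ⊙-identityʳ ; ⊙-identityˡ = ⊙-identityˡ
    ; ⊙-comm = ⊙-comm
    ; ⊙-defined→ = ⊙-defined⇒′≤ ; ⊙-defined← = ′≤⇒⊙-defined
    ; ⊙-mono = ⊙-monoˡ-≤ ; ⊙-divide = ⊙-divide
    ; residuation→ = residuation→ ; residuation← = residuation←
    ; ⇒-zero = ⇒-zero
    }
  ; divisible = ⊙-⇒-divisible
  }
  where open EffectAlgebraProperties isEffectAlgebra
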